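{- Let $k\ge1$ be an integer and $p$ a prime with $p>2k$. Then for all positive integers $m$, \[ \kappa_p(m)\ \ge\ W_p(m,k)=V_p(m,k). \]
   Context: $\nu_p$ is the $p$-adic valuation. $\kappa_p(m):=\nu_p\binom{2m}{m}$, $W_p(m,k):=\nu_p\big(\prod_{i=1}^k(m+i)\big)$ and $V_p(m,k):=\max_{1\le i\le k}\nu_p(m+i)$. -}

module Defs where

open import Data.Nat using (ℕ; zero; suc; _+_; _*_; _⊔_; NonZero)
open import Data.Nat.DivMod using (_/_)
open import Data.Nat.Divisibility using (_∣?_)
open import Data.Nat.Combinatorics using (_C_)
open import Relation.Nullary using (yes; no)

-- With fuel = n this is the exact valuation for
-- p ≥ 2 and n ≥ 1, since p ^ v ≤ n forces v < n.
νAux : ℕ → (p : ℕ) → .{{NonZero p}} → ℕ → ℕ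
νAux zero    p n = 0
νAux (suc f) p n with p ∣? n
... | yes _ = suc (νAux f p (n / p))
... | no  _ = 0

-- ν p n = ν_p(n), the p-adic valuation (convention ν p 0 = 0; only used for n ≥ 1).
ν : (p : ℕ) → .{{NonZero p}} → ℕ → ℕ
ν p n = νAux n p n

κ : (p : ℕ) → .{{NonZero p}} → ℕ → ℕ
κ p m = ν p ((2 * m) C m)

prodShift : ℕ → ℕ → ℕ
prodShift m zero    = 1
prodShift m (suc k) = prodShift m k * (m + suc k)

W : (p : ℕ) → .{{NonZero p}} → ℕ → ℕ → ℕ
W p m k = ν p (prodShift m k)

V : (p : ℕ) → .{{NonZero p}} → ℕ → ℕ → ℕ
V p m zero    = 0
V p m (suc k) = V p m k ⊔ ν p (m + suc k)

{-# OPTIONS --safe #-}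
module Submission where

-- Since k < p, at most one of m+1, …, m+k is a multiple of p, so the valuation of their
-- product is the largest of their valuations.  Iterating C(2s+2, s+1)·(s+1) = 2(2s+1)·C(2s, s)
-- gives C(2(m+j), m+j)·(m+1)⋯(m+j) = C(2m, m)·∏_{d<j} 2(2(m+d)+1).  If p ∣ m+j and 2j < p,
-- no factor 2(2(m+d)+1) is a multiple of p, since p is odd and 2(m+j) − (2(m+d)+1) = 2(j−d)−1
-- lies strictly between 0 and p; hence ν_p(m+j) ≤ κ_p(m).

open import Defs
open import Data.Nat
open import Data.Nat.Properties
open import Data.Nat.DivMod using (_/_; m*[n/m]≡n; m/n*n≡m; m/n<m; m≥n⇒m/n>0)
open import Data.Nat.Divisibility
open import Data.Nat.Combinatorics using (_C_; nCk≡n!/k![n-k]!; k![n∸k]!∣n!)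
open import Data.Nat.Primality using (Prime; euclidsLemma; prime⇒nonTrivial)
open import Data.Nat.Tactic.RingSolver using (solve-∀)
open import Data.Product using (_×_; _,_)
open import Data.Sum using (_⊎_; inj₁; inj₂)
open import Relation.Nullary using (yes; no; contradiction)
open import Relation.Binary.PropositionalEquality
open import Algebra.Properties.CommutativeSemigroup *-commutativeSemigroup
  using (interchange; x∙yz≈xz∙y; xy∙z≈xz∙y)

^-monoʳ-∣ : ∀ m {a b} → a ≤ b → m ^ a ∣ m ^ b
^-monoʳ-∣ m {a} {b} a≤b = divides (m ^ (b ∸ a)) (begin
  m ^ b               ≡⟨ cong (m ^_) (m∸n+n≡m a≤b) ⟨
  m ^ (b ∸ a + a)     ≡⟨ ^-distribˡ-+-* m (b ∸ a) a ⟩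
  m ^ (b ∸ a) * m ^ a ∎)
  where open ≡-Reasoning

∣m+n⇒∤m : ∀ {d m n} → d ∣ m + n → 0 < n → n < d → d ∤ m
∣m+n⇒∤m d∣m+n 0<n n<d d∣m = >⇒∤ {{>-nonZero 0<n}} n<d (∣m+n∣m⇒∣n d∣m+n d∣m)

m≡0⊎n≡0⇒m+n≡m⊔n : ∀ {m n} → m ≡ 0 ⊎ n ≡ 0 → m + n ≡ m ⊔ n
m≡0⊎n≡0⇒m+n≡m⊔n         (inj₁ refl) = refl
m≡0⊎n≡0⇒m+n≡m⊔n {m} {n} (inj₂ refl) = trans (+-identityʳ m) (sym (⊔-identityʳ m))

prodShift≢0 : ∀ m k → NonZero (prodShift m k)
prodShift≢0 m zero    = _
prodShift≢0 m (suc k) = m*n≢0 _ _ {{prodShift≢0 m k}} {{≢-nonZero (m+1+n≢0 m)}}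

centralBinomial : ℕ → ℕ
centralBinomial s = (2 * s) C s

nCk*[k!*[n∸k]!]≡n! : ∀ {n k} → k ≤ n → (n C k) * (k ! * (n ∸ k) !) ≡ n !
nCk*[k!*[n∸k]!]≡n! {n} {k} k≤n =
  trans (cong (_* (k ! * (n ∸ k) !)) (nCk≡n!/k![n-k]! k≤n))
        (m/n*n≡m {{k !* (n ∸ k) !≢0}} (k![n∸k]!∣n! k≤n))

centralBinomial*s!*s!≡[2s]! : ∀ s → centralBinomial s * (s ! * s !) ≡ (2 * s) !
centralBinomial*s!*s!≡[2s]! s =
  subst (λ t → centralBinomial s * (s ! * t !) ≡ (2 * s) !) 2s∸s≡s
        (nCk*[k!*[n∸k]!]≡n! (m≤m+n s (s + 0)))
  where
  2s∸s≡s : 2 * s ∸ s ≡ s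
  2s∸s≡s = trans (m+n∸m≡n s (s + 0)) (+-identityʳ s)

centralBinomial≢0 : ∀ s → NonZero (centralBinomial s)
centralBinomial≢0 s = m*n≢0⇒m≢0 (centralBinomial s)
  {{subst NonZero (sym (centralBinomial*s!*s!≡[2s]! s)) ((2 * s) !≢0)}}

centralBinomial-suc : ∀ s → centralBinomial (suc s) * suc s ≡ centralBinomial s * (2 * suc (2 * s))
centralBinomial-suc s = *-cancelʳ-≡ _ _ d {{d≢0}} (begin
  c′ * suc s * d                                     ≡⟨ regroupˡ c′ s (s !) ⟩
  c′ * (suc s ! * suc s !)                           ≡⟨ centralBinomial*s!*s!≡[2s]! (suc s) ⟩
  (2 * suc s) !                                      ≡⟨ cong _! (*-suc 2 s) ⟩
  (2 + 2 * s) * ((1 + 2 * s) * (2 * s) !)            ≡⟨ cong (λ t → (2 + 2 * s) * ((1 + 2 * s) * t))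
                                                             (centralBinomial*s!*s!≡[2s]! s) ⟨
  (2 + 2 * s) * ((1 + 2 * s) * (c * (s ! * s !)))    ≡⟨ regroupʳ c s (s !) ⟩
  c * (2 * suc (2 * s)) * d                          ∎)
  where
  open ≡-Reasoning
  c c′ d : ℕ
  c  = centralBinomial s
  c′ = centralBinomial (suc s)
  d  = suc s * (s ! * s !)
  d≢0 : NonZero d
  d≢0 = m*n≢0 (suc s) _ {{_}} {{s !* s !≢0}}
  regroupˡ : ∀ x s f → x * (1 + s) * ((1 + s) * (f * f)) ≡ x * (((1 + s) * f) * ((1 + s) * f))
  regroupˡ = solve-∀
  regroupʳ : ∀ x s f → (2 + 2 * s) * ((1 + 2 * s) * (x * (f * f))) ≡ x * (2 * (1 + 2 * s)) * ((1 + s) * (f * f))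
  regroupʳ = solve-∀

doubledOdds : ℕ → ℕ → ℕ
doubledOdds m zero    = 1
doubledOdds m (suc j) = doubledOdds m j * (2 * suc (2 * (m + j)))

doubledOdds≢0 : ∀ m j → NonZero (doubledOdds m j)
doubledOdds≢0 m zero    = _
doubledOdds≢0 m (suc j) = m*n≢0 _ _ {{doubledOdds≢0 m j}} {{_}}

centralBinomial-shift : ∀ m j →
  centralBinomial (m + j) * prodShift m j ≡ centralBinomial m * doubledOdds m j
centralBinomial-shift m zero    = cong (λ t → centralBinomial t * 1) (+-identityʳ m)
centralBinomial-shift m (suc j) = begin
  c (m + suc j) * (P * (m + suc j))       ≡⟨ cong (λ t → c t * (P * t)) (+-suc m j) ⟩
  c (suc (m + j)) * (P * suc (m + j))     ≡⟨ x∙yz≈xz∙y (c (suc (m + j))) P (suc (m + j)) ⟩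
  c (suc (m + j)) * suc (m + j) * P       ≡⟨ cong (_* P) (centralBinomial-suc (m + j)) ⟩
  c (m + j) * odd * P                     ≡⟨ xy∙z≈xz∙y (c (m + j)) odd P ⟩
  c (m + j) * P * odd                     ≡⟨ cong (_* odd) (centralBinomial-shift m j) ⟩
  c m * doubledOdds m j * odd             ≡⟨ *-assoc (c m) _ odd ⟩
  c m * doubledOdds m (suc j)             ∎
  where
  open ≡-Reasoning
  c : ℕ → ℕ
  c = centralBinomial
  P odd : ℕ
  P   = prodShift m j
  odd = 2 * suc (2 * (m + j))

module _ {p : ℕ} .{{_ : NonZero p}} where

  p^νAux∣n : ∀ f n → p ^ νAux f p n ∣ n
  p^νAux∣n zero    n = 1∣ n
  p^νAux∣n (suc f) n with p ∣? n
  ... | yes p∣n =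
    subst (p * p ^ νAux f p (n / p) ∣_) (m*[n/m]≡n p∣n) (*-monoʳ-∣ p (p^νAux∣n f (n / p)))
  ... | no  _   = 1∣ n

  p^ν∣n : ∀ n → p ^ ν p n ∣ n
  p^ν∣n n = p^νAux∣n n n

  p∤n⇒ν≡0 : ∀ {n} → p ∤ n → ν p n ≡ 0
  p∤n⇒ν≡0 {zero}  p∤0 = contradiction (p ∣0) p∤0
  p∤n⇒ν≡0 {suc n} p∤n with p ∣? suc n
  ... | yes p∣n = contradiction p∣n p∤n
  ... | no  _   = refl

  V≡0 : ∀ m k → (∀ i → i < k → p ∤ m + suc i) → V p m k ≡ 0
  V≡0 m zero    _   = refl
  V≡0 m (suc k) p∤m+1+i =
    cong₂ _⊔_ (V≡0 m k (λ i i<k → p∤m+1+i i (m<n⇒m<1+n i<k))) (p∤n⇒ν≡0 (p∤m+1+i k (n<1+n k)))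

  V≡0⊎ν≡0 : ∀ m k → k < p → V p m k ≡ 0 ⊎ ν p (m + suc k) ≡ 0
  V≡0⊎ν≡0 m k k<p with p ∣? m + suc k
  ... | no  p∤m+1+k = inj₂ (p∤n⇒ν≡0 p∤m+1+k)
  ... | yes p∣m+1+k = inj₁ (V≡0 m k p∤m+1+i)
    where
    p∤m+1+i : ∀ i → i < k → p ∤ m + suc i
    p∤m+1+i i i<k =
      ∣m+n⇒∤m (subst (p ∣_) split p∣m+1+k) (m<n⇒0<n∸m i<k) (≤-<-trans (m∸n≤m k i) k<p)
      where
      split : m + suc k ≡ m + suc i + (k ∸ i)
      split = trans (cong (λ t → m + suc t) (sym (m+[n∸m]≡n (<⇒≤ i<k))))
                    (sym (+-assoc m (suc i) (k ∸ i)))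

  V-lub : ∀ m k {c} → (∀ i → i < k → ν p (m + suc i) ≤ c) → V p m k ≤ c
  V-lub m zero    _ = z≤n
  V-lub m (suc k) h = ⊔-lub (V-lub m k (λ i i<k → h i (m<n⇒m<1+n i<k))) (h k (n<1+n k))

module _ {p : ℕ} .{{_ : NonZero p}} (1<p : 1 < p) where

  p^e∣n⇒e≤νAux : ∀ f {e n} .{{_ : NonZero n}} → n ≤ f → p ^ e ∣ n → e ≤ νAux f p n
  p^e∣n⇒e≤νAux f       {zero}      _     _        = z≤n
  p^e∣n⇒e≤νAux zero    {suc e} {n} n≤0   _        = contradiction (n≤0⇒n≡0 n≤0) (≢-nonZero⁻¹ n)
  p^e∣n⇒e≤νAux (suc f) {suc e} {n} n≤1+f p^1+e∣n with p ∣? n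
  ... | no  p∤n = contradiction (∣-trans (m∣m*n (p ^ e)) p^1+e∣n) p∤n
  ... | yes p∣n = s≤s (p^e∣n⇒e≤νAux f {{n/p≢0}} n/p≤f (m*n∣o⇒n∣o/m p (p ^ e) p^1+e∣n))
    where
    n/p≢0 : NonZero (n / p)
    n/p≢0 = >-nonZero (m≥n⇒m/n>0 (∣⇒≤ p∣n))
    n/p≤f : n / p ≤ f
    n/p≤f = ≤-pred (≤-trans (m/n<m n p 1<p) n≤1+f)

  p^e∣n⇒e≤ν : ∀ {e n} .{{_ : NonZero n}} → p ^ e ∣ n → e ≤ ν p n
  p^e∣n⇒e≤ν {n = n} = p^e∣n⇒e≤νAux n ≤-refl

  p^[1+ν]∤n : ∀ {n} .{{_ : NonZero n}} → p ^ suc (ν p n) ∤ n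
  p^[1+ν]∤n p^1+ν∣n = <-irrefl refl (p^e∣n⇒e≤ν p^1+ν∣n)

  ∣⇒ν≤ : ∀ {m n} .{{_ : NonZero n}} → m ∣ n → ν p m ≤ ν p n
  ∣⇒ν≤ m∣n = p^e∣n⇒e≤ν (∣-trans (p^ν∣n _) m∣n)

  ν-unique : ∀ {e n} .{{_ : NonZero n}} → p ^ e ∣ n → p ^ suc e ∤ n → ν p n ≡ e
  ν-unique p^e∣n p^1+e∤n = ≤-antisym
    (≮⇒≥ (λ e<ν → p^1+e∤n (∣-trans (^-monoʳ-∣ p e<ν) (p^ν∣n _))))
    (p^e∣n⇒e≤ν p^e∣n)

  ν[p^e*u]≡e : ∀ e {u} .{{_ : NonZero u}} → p ∤ u → ν p (p ^ e * u) ≡ e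
  ν[p^e*u]≡e e {u} p∤u = ν-unique {{m*n≢0 (p ^ e) u {{m^n≢0 p e}}}} (m∣m*n u) p^1+e∤p^e*u
    where
    p^1+e∤p^e*u : p ^ suc e ∤ p ^ e * u
    p^1+e∤p^e*u p^1+e∣ =
      p∤u (*-cancelˡ-∣ (p ^ e) {{m^n≢0 p e}} (subst (_∣ p ^ e * u) (*-comm p (p ^ e)) p^1+e∣))

  p∤cofactor : ∀ n .{{_ : NonZero n}} → p ∤ quotient (p^ν∣n {p} n)
  p∤cofactor n p∣n′ = p^[1+ν]∤n (subst₂ _∣_ (*-comm (p ^ ν p n) p)
    (sym (m∣n⇒n≡m*quotient (p^ν∣n {p} n))) (*-monoʳ-∣ (p ^ ν p n) p∣n′))

module _ {p : ℕ} .{{_ : NonZero p}} (p-prime : Prime p) where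

  private
    1<p : 1 < p
    1<p = nonTrivial⇒n>1 p {{prime⇒nonTrivial p-prime}}

  p∤m⇒p∤n⇒p∤m*n : ∀ {m n} → p ∤ m → p ∤ n → p ∤ m * n
  p∤m⇒p∤n⇒p∤m*n {m} {n} p∤m p∤n p∣m*n with euclidsLemma m n p-prime p∣m*n
  ... | inj₁ p∣m = p∤m p∣m
  ... | inj₂ p∣n = p∤n p∣n

  ν-* : ∀ {a b} .{{_ : NonZero a}} .{{_ : NonZero b}} → ν p (a * b) ≡ ν p a + ν p b
  ν-* {a} {b} = begin
    ν p (a * b)                           ≡⟨ cong (ν p) (cong₂ _*_ a≡p^α*a′ b≡p^β*b′) ⟩
    ν p ((p ^ α * a′) * (p ^ β * b′))     ≡⟨ cong (ν p) (interchange (p ^ α) a′ (p ^ β) b′) ⟩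
    ν p ((p ^ α * p ^ β) * (a′ * b′))     ≡⟨ cong (λ q → ν p (q * (a′ * b′))) (^-distribˡ-+-* p α β) ⟨
    ν p (p ^ (α + β) * (a′ * b′))         ≡⟨ ν[p^e*u]≡e 1<p (α + β) {{a′*b′≢0}} p∤a′*b′ ⟩
    α + β                                 ∎
    where
    open ≡-Reasoning
    α β a′ b′ : ℕ
    α  = ν p a
    β  = ν p b
    a′ = quotient (p^ν∣n {p} a)
    b′ = quotient (p^ν∣n {p} b)
    a≡p^α*a′ : a ≡ p ^ α * a′
    a≡p^α*a′ = m∣n⇒n≡m*quotient (p^ν∣n a)
    b≡p^β*b′ : b ≡ p ^ β * b′
    b≡p^β*b′ = m∣n⇒n≡m*quotient (p^ν∣n b)
    a′*b′≢0 : NonZero (a′ * b′)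
    a′*b′≢0 = m*n≢0 a′ b′ {{quotient≢0 (p^ν∣n {p} a)}} {{quotient≢0 (p^ν∣n {p} b)}}
    p∤a′*b′ : p ∤ a′ * b′
    p∤a′*b′ = p∤m⇒p∤n⇒p∤m*n (p∤cofactor 1<p a) (p∤cofactor 1<p b)

  W≡V : ∀ m k → k < p → W p m k ≡ V p m k
  W≡V m zero    _     = p∤n⇒ν≡0 (>⇒∤ 1<p)
  W≡V m (suc k) 1+k<p = begin
    W p m (suc k)                ≡⟨ ν-* {{prodShift≢0 m k}} {{≢-nonZero (m+1+n≢0 m)}} ⟩
    W p m k + ν p (m + suc k)    ≡⟨ cong (_+ ν p (m + suc k)) (W≡V m k (<⇒≤ 1+k<p)) ⟩
    V p m k + ν p (m + suc k)    ≡⟨ m≡0⊎n≡0⇒m+n≡m⊔n (V≡0⊎ν≡0 m k (<⇒≤ 1+k<p)) ⟩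
    V p m (suc k)                ∎
    where open ≡-Reasoning

  p∤doubledOddsFactor : ∀ m j d → d < j → p ∣ m + j → 2 * j < p → p ∤ 2 * suc (2 * (m + d))
  p∤doubledOddsFactor m j d d<j p∣m+j 2j<p with m≤n⇒∃[o]m+o≡n d<j
  ... | r , refl = p∤m⇒p∤n⇒p∤m*n (>⇒∤ 2<p) p∤odd
    where
    2<p : 2 < p
    2<p = ≤-<-trans (*-monoʳ-≤ 2 (s≤s z≤n)) 2j<p
    split : ∀ m d r → 2 * (m + (suc d + r)) ≡ suc (2 * (m + d)) + suc (2 * r)
    split = solve-∀
    1+2r<p : suc (2 * r) < p
    1+2r<p = <-trans (subst (suc (2 * r) <_) (sym (*-suc 2 r)) (n<1+n _))
                     (≤-<-trans (*-monoʳ-≤ 2 (s≤s (m≤n+m r d))) 2j<p)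
    p∤odd : p ∤ suc (2 * (m + d))
    p∤odd = ∣m+n⇒∤m (subst (p ∣_) (split m d r) (∣n⇒∣m*n 2 p∣m+j)) (s≤s z≤n) 1+2r<p

  p∤doubledOdds : ∀ m j d → d ≤ j → p ∣ m + j → 2 * j < p → p ∤ doubledOdds m d
  p∤doubledOdds m j zero    _   _     _    = >⇒∤ 1<p
  p∤doubledOdds m j (suc d) d<j p∣m+j 2j<p =
    p∤m⇒p∤n⇒p∤m*n (p∤doubledOdds m j d (<⇒≤ d<j) p∣m+j 2j<p)
                  (p∤doubledOddsFactor m j d d<j p∣m+j 2j<p)

  ν[m+1+j]≤κ : ∀ m j → 2 * suc j < p → ν p (m + suc j) ≤ κ p m
  ν[m+1+j]≤κ m j 2j<p with p ∣? m + suc j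
  ... | no  p∤m+1+j = subst (_≤ κ p m) (sym (p∤n⇒ν≡0 p∤m+1+j)) z≤n
  ... | yes p∣m+1+j = begin
    ν p (m + suc j)                            ≤⟨ ∣⇒ν≤ 1<p {{c′*P≢0}} (∣n⇒∣m*n c′ (n∣m*n (prodShift m j))) ⟩
    ν p (c′ * prodShift m (suc j))             ≡⟨ cong (ν p) (centralBinomial-shift m (suc j)) ⟩
    ν p (centralBinomial m * q)                ≡⟨ ν-* {{centralBinomial≢0 m}} {{doubledOdds≢0 m (suc j)}} ⟩
    κ p m + ν p q                              ≡⟨ cong (κ p m +_) (p∤n⇒ν≡0 p∤q) ⟩
    κ p m + 0                                  ≡⟨ +-identityʳ (κ p m) ⟩
    κ p m                                      ∎
    where
    open ≤-Reasoning
    c′ q : ℕ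
    c′ = centralBinomial (m + suc j)
    q  = doubledOdds m (suc j)
    c′*P≢0 : NonZero (c′ * prodShift m (suc j))
    c′*P≢0 = m*n≢0 _ _ {{centralBinomial≢0 (m + suc j)}} {{prodShift≢0 m (suc j)}}
    p∤q : p ∤ q
    p∤q = p∤doubledOdds m (suc j) (suc j) ≤-refl p∣m+1+j 2j<p

lemma5 : (k p : ℕ) → .{{_ : NonZero p}} → k ≥ 1 → Prime p → p > 2 * k →
    (m : ℕ) → m ≥ 1 →
    (κ p m ≥ W p m k) × (W p m k ≡ V p m k)
lemma5 k p _ p-prime 2k<p m _ = W≤κ , W≡V′
  where
  k<p : k < p
  k<p = ≤-<-trans (m≤m+n k (k + 0)) 2k<p
  W≡V′ : W p m k ≡ V p m k
  W≡V′ = W≡V p-prime m k k<p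
  W≤κ : W p m k ≤ κ p m
  W≤κ = subst (_≤ κ p m) (sym W≡V′)
          (V-lub m k (λ i i<k → ν[m+1+j]≤κ p-prime m i (≤-<-trans (*-monoʳ-≤ 2 i<k) 2k<p)))
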